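{- Let $w_1,\ldots,w_k\in\mathcal S_m$ and suppose $w\in\mathcal S_\infty$ satisfies $w\ge w_i$ for all $i$. Then there exists $w'\in\mathcal S_m$ with $\vee\{w_1,\ldots,w_k\}\le w'\le w$.
   Context: $\mathcal S_\infty=\bigcup_n\mathcal S_n$, where $\mathcal S_n\subseteq\mathcal S_{n+1}$ by fixing $n+1$. Permutations are identified with permutation matrices (1 at $(i,w(i))$), which are alternating sign matrices (ASMs: square matrices with entries in $\{ -1,0,1\}$, nonzero entries alternating in sign along rows and columns, each row and column summing to 1). ASMs of size $n$ are embedded in size $n+1$ via $A\mapsto{\rm diag}(A,1)$. Order: $A\le B$ iff $r_A(i,j)\ge r_B(i,j)$ for all $i,j$, where $r_A(i,j)=\sum_{k\le i,l\le j}a_{kl}$ (compared in a common size; on permutations this is Bruhat order). The join $\vee$ of a finite set of ASMs is the ASM whose corner sum function is the entrywise minimum of theirs. -}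

module Defs where

open import Data.Nat as ℕ using (ℕ; zero; suc; _<?_; _⊔_; _≡ᵇ_)
open import Data.Nat.Properties using (m≤m⊔n; m≤n⊔m)
open import Data.Integer as ℤ using (ℤ; +_; _+_; _-_; _⊓_)
open import Data.Fin using (Fin; toℕ; fromℕ<; zero; suc)
open import Data.Fin.Properties using () renaming (_≟_ to _≟ᶠ_)
open import Data.Fin.Permutation using (Permutation′; _⟨$⟩ʳ_)
open import Data.Bool using (if_then_else_)
open import Relation.Nullary.Decidable using (yes; no; does)

Matrix : ℕ → Set
Matrix n = Fin n → Fin n → ℤ

permMatrix : ∀ {n} → Permutation′ n → Matrix n
permMatrix w i j = if does ((w ⟨$⟩ʳ i) ≟ᶠ j) then + 1 else + 0

-- Entry (i,j) of diag(A, 1, 1, 1, ...) for arbitrary i j : ℕ.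
padded : ∀ {n} → Matrix n → ℕ → ℕ → ℤ
padded {n} A i j with i <? n | j <? n
... | yes p | yes q = A (fromℕ< p) (fromℕ< q)
... | _     | _     = if i ≡ᵇ j then + 1 else + 0

embed : ∀ {n} (N : ℕ) → Matrix n → Matrix N
embed N A i j = padded A (toℕ i) (toℕ j)

Σ< : ℕ → (ℕ → ℤ) → ℤ
Σ< zero    f = + 0
Σ< (suc i) f = Σ< i f + f i

-- Corner sum r_A(i,j) = Σ_{k ≤ i, l ≤ j} a_kl (1-indexed), i.e. sum over the
-- first i rows and first j columns; meaningful for 0 ≤ i, j ≤ n.
cornerSum : ∀ {n} → Matrix n → ℕ → ℕ → ℤ
cornerSum A i j = Σ< i (λ k → Σ< j (λ l → padded A k l))

-- The order on ASMs of possibly different sizes: A ≤ B iff r_A ≥ r_B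
-- entrywise, compared in the common size N = m ⊔ n.
_≼_ : ∀ {m n} → Matrix m → Matrix n → Set
_≼_ {m} {n} A B = ∀ i j → i ℕ.≤ m ⊔ n → j ℕ.≤ m ⊔ n →
  cornerSum (embed (m ⊔ n) B) i j ℤ.≤ cornerSum (embed (m ⊔ n) A) i j

minFin : ∀ {k} → (Fin (suc k) → ℤ) → ℤ
minFin {zero}  f = f zero
minFin {suc k} f = f zero ⊓ minFin (λ t → f (suc t))

joinCornerSum : ∀ {m k} → (Fin (suc k) → Matrix m) → ℕ → ℕ → ℤ
joinCornerSum As i j = minFin (λ t → cornerSum (As t) i j)

-- The join ∨{A_1,...,A_{k+1}}: the size-m matrix whose corner sum function is
-- joinCornerSum (entries recovered as mixed second differences).
join : ∀ {m k} → (Fin (suc k) → Matrix m) → Matrix m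
join As a b =
  let R = joinCornerSum As ; i = toℕ a ; j = toℕ b in
  R (suc i) (suc j) - R i (suc j) - R (suc i) j + R i j

-- For every m and every w ∈ S_n the set {v ∈ S_m : v ≤ w} has a greatest
-- element; it is the required w′, because each wᵢ lies below it and the join is
-- the least upper bound.  The greatest element is built one size at a time.  For
-- w ∈ S_{N+1} with a = w⁻¹(N) < N, let c ∈ (a, N] maximise w on (a, N]; then
-- u = w ∘ (a c) satisfies u ≤ w, every v ∈ S_N below w is also below u, and
-- u⁻¹(N) = c > a.  Iterating until N is a fixed point lands in S_N.
module Submission where

open import Defs
open import Data.Nat using (ℕ; zero; suc; _+_; _∸_; _≤_; _<_; _≤?_; _<?_; _≟_; _⊔_; _≡ᵇ_; z≤n; s≤s)
open import Data.Nat.Properties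
open import Data.Integer as ℤ using (ℤ; +≤+)
import Data.Integer.Properties as ℤP
open import Data.Integer.Tactic.RingSolver using (solve-∀)
open import Algebra.Properties.CommutativeSemigroup +-commutativeSemigroup using (interchange; xy∙z≈xz∙y)
open import Data.Fin as Fin using (Fin; toℕ; fromℕ<)
open import Data.Fin.Properties using (toℕ-fromℕ<; fromℕ<-toℕ; toℕ<n; toℕ-injective) renaming (_≟_ to _≟ᶠ_)
open import Data.Fin.Permutation using (Permutation′; _⟨$⟩ʳ_; _⟨$⟩ˡ_; permutation; inverseʳ; inverseˡ)
open import Data.Bool using (true; false; if_then_else_; T)
open import Data.Empty using (⊥-elim)
open import Data.Sum using (_⊎_; inj₁; inj₂; [_,_])
open import Data.Product using (Σ; _×_; _,_)
open import Function using (_∘_)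
open import Relation.Nullary using (Dec; yes; no; ¬_; does)
open import Relation.Binary.PropositionalEquality hiding ([_])

-- (1) Indicators and bounded sums

𝟙 : {P : Set} → Dec P → ℕ
𝟙 (yes _) = 1
𝟙 (no _)  = 0

𝟙-yes : {P : Set} (p : Dec P) → P → 𝟙 p ≡ 1
𝟙-yes (yes _) _ = refl
𝟙-yes (no ¬p) p = ⊥-elim (¬p p)

𝟙-no : {P : Set} (p : Dec P) → ¬ P → 𝟙 p ≡ 0
𝟙-no (yes p) ¬p = ⊥-elim (¬p p)
𝟙-no (no _)  _  = refl

𝟙≤1 : {P : Set} (p : Dec P) → 𝟙 p ≤ 1
𝟙≤1 (yes _) = ≤-refl
𝟙≤1 (no _)  = z≤n

𝟙-mono : {P Q : Set} (p : Dec P) (q : Dec Q) → (P → Q) → 𝟙 p ≤ 𝟙 q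
𝟙-mono (yes p) q P→Q = ≤-reflexive (sym (𝟙-yes q (P→Q p)))
𝟙-mono (no _)  _ _   = z≤n

𝟙-cong : {P Q : Set} (p : Dec P) (q : Dec Q) → (P → Q) → (Q → P) → 𝟙 p ≡ 𝟙 q
𝟙-cong p q P→Q Q→P = ≤-antisym (𝟙-mono p q P→Q) (𝟙-mono q p Q→P)

sumBelow : ℕ → (ℕ → ℕ) → ℕ
sumBelow zero    f = 0
sumBelow (suc i) f = sumBelow i f + f i

sumBelow-cong : ∀ i {f g : ℕ → ℕ} → (∀ k → k < i → f k ≡ g k) → sumBelow i f ≡ sumBelow i g
sumBelow-cong zero    f≡g = refl
sumBelow-cong (suc i) f≡g =
  cong₂ _+_ (sumBelow-cong i (λ k k<i → f≡g k (m<n⇒m<1+n k<i))) (f≡g i ≤-refl)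

sumBelow-zeros : ∀ i → sumBelow i (λ _ → 0) ≡ 0
sumBelow-zeros zero    = refl
sumBelow-zeros (suc i) = cong (_+ 0) (sumBelow-zeros i)

sumBelow-ones : ∀ i f → (∀ k → k < i → f k ≡ 1) → sumBelow i f ≡ i
sumBelow-ones zero    f ones = refl
sumBelow-ones (suc i) f ones = begin
  sumBelow i f + f i ≡⟨ cong₂ _+_ (sumBelow-ones i f (λ k k<i → ones k (m<n⇒m<1+n k<i))) (ones i ≤-refl) ⟩
  i + 1              ≡⟨ +-comm i 1 ⟩
  suc i              ∎
  where open ≡-Reasoning

sumBelow-≤ : ∀ i f → (∀ k → f k ≤ 1) → sumBelow i f ≤ i
sumBelow-≤ zero    f f≤1 = z≤n
sumBelow-≤ (suc i) f f≤1 = subst (sumBelow i f + f i ≤_) (+-comm i 1) (+-mono-≤ (sumBelow-≤ i f f≤1) (f≤1 i))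

sumBelow-split : ∀ i d f → sumBelow (i + d) f ≡ sumBelow i f + sumBelow d (λ e → f (i + e))
sumBelow-split i zero    f rewrite +-identityʳ i = sym (+-identityʳ (sumBelow i f))
sumBelow-split i (suc d) f rewrite +-suc i d | sumBelow-split i d f =
  +-assoc (sumBelow i f) (sumBelow d (λ e → f (i + e))) (f (i + d))

sumBelow-+ : ∀ i f g → sumBelow i (λ k → f k + g k) ≡ sumBelow i f + sumBelow i g
sumBelow-+ zero    f g = refl
sumBelow-+ (suc i) f g rewrite sumBelow-+ i f g =
  interchange (sumBelow i f) (sumBelow i g) (f i) (g i)

sumBelow-swap : ∀ i j (h : ℕ → ℕ → ℕ) →
  sumBelow i (λ k → sumBelow j (h k)) ≡ sumBelow j (λ l → sumBelow i (λ k → h k l))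
sumBelow-swap zero    j h = sym (sumBelow-zeros j)
sumBelow-swap (suc i) j h rewrite sumBelow-swap i j h =
  sym (sumBelow-+ j (λ l → sumBelow i (λ k → h k l)) (h i))

sumBelow-point : ∀ x j → sumBelow j (λ l → 𝟙 (x ≟ l)) ≡ 𝟙 (x <? j)
sumBelow-point x zero = sym (𝟙-no (x <? 0) λ ())
sumBelow-point x (suc j) rewrite sumBelow-point x j with x <? j | x ≟ j
... | yes x<j | yes refl = ⊥-elim (<-irrefl refl x<j)
... | yes x<j | no _     = sym (𝟙-yes (x <? suc j) (m<n⇒m<1+n x<j))
... | no _    | yes refl = sym (𝟙-yes (x <? suc j) ≤-refl)
... | no x≮j  | no x≢j   = sym (𝟙-no (x <? suc j) ([ x≮j , x≢j ] ∘ m<1+n⇒m<n∨m≡n))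

-- (2) Finitary permutations of ℕ and their ranks

-- A bijection of ℕ, given with its inverse, that fixes every x ≥ n: an element
-- of S_n ⊆ S_∞ (0-indexed).
record FinPerm (n : ℕ) : Set where
  field
    fun inv : ℕ → ℕ
    fun-inv : ∀ x → fun (inv x) ≡ x
    inv-fun : ∀ x → inv (fun x) ≡ x
    fixes   : ∀ x → n ≤ x → fun x ≡ x
open FinPerm

inv-fixes : ∀ {n} (w : FinPerm n) x → n ≤ x → inv w x ≡ x
inv-fixes w x n≤x = trans (cong (inv w) (sym (fixes w x n≤x))) (inv-fun w x)

inverse : ∀ {n} → FinPerm n → FinPerm n
inverse w = record
  { fun = inv w ; inv = fun w ; fun-inv = inv-fun w ; inv-fun = fun-inv w ; fixes = inv-fixes w }

fun-bounded : ∀ {n} (w : FinPerm n) x → x < n → fun w x < n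
fun-bounded {n} w x x<n with n ≤? fun w x
... | no n≰wx = ≰⇒> n≰wx
... | yes n≤wx = ⊥-elim (<⇒≱ x<n (subst (n ≤_) wx≡x n≤wx))
  where
  wx≡x : fun w x ≡ x
  wx≡x = trans (sym (inv-fun w (fun w x))) (trans (cong (inv w) (fixes w (fun w x) n≤wx)) (inv-fun w x))

inv-bounded : ∀ {n} (w : FinPerm n) x → x < n → inv w x < n
inv-bounded w = fun-bounded (inverse w)

weaken : ∀ {n N} → n ≤ N → FinPerm n → FinPerm N
weaken n≤N w = record
  { fun = fun w ; inv = inv w ; fun-inv = fun-inv w ; inv-fun = inv-fun w
  ; fixes = λ x N≤x → fixes w x (≤-trans n≤N N≤x) }

-- rank f i j = #{k < i : f k < j}, the corner sum of the permutation matrix of f.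
rank : (ℕ → ℕ) → ℕ → ℕ → ℕ
rank f i j = sumBelow i (λ k → 𝟙 (f k <? j))

rank-cong : ∀ {f g : ℕ → ℕ} → (∀ k → f k ≡ g k) → ∀ i j → rank f i j ≡ rank g i j
rank-cong f≡g i j = sumBelow-cong i (λ k _ → cong (λ x → 𝟙 (x <? j)) (f≡g k))

rank-by-columns : ∀ {n} (w : FinPerm n) i j →
  rank (fun w) i j ≡ sumBelow j (λ l → 𝟙 (inv w l <? i))
rank-by-columns w i j = begin
  sumBelow i (λ k → 𝟙 (fun w k <? j))
    ≡⟨ sumBelow-cong i (λ k _ → sym (sumBelow-point (fun w k) j)) ⟩
  sumBelow i (λ k → sumBelow j (λ l → 𝟙 (fun w k ≟ l)))
    ≡⟨ sumBelow-swap i j (λ k l → 𝟙 (fun w k ≟ l)) ⟩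
  sumBelow j (λ l → sumBelow i (λ k → 𝟙 (fun w k ≟ l)))
    ≡⟨ sumBelow-cong j (λ l _ → sumBelow-cong i (λ k _ → graph-flip k l)) ⟩
  sumBelow j (λ l → sumBelow i (λ k → 𝟙 (inv w l ≟ k)))
    ≡⟨ sumBelow-cong j (λ l _ → sumBelow-point (inv w l) i) ⟩
  sumBelow j (λ l → 𝟙 (inv w l <? i))
    ∎
  where
  open ≡-Reasoning
  graph-flip : ∀ k l → 𝟙 (fun w k ≟ l) ≡ 𝟙 (inv w l ≟ k)
  graph-flip k l = 𝟙-cong (fun w k ≟ l) (inv w l ≟ k)
    (λ wk≡l → trans (cong (inv w) (sym wk≡l)) (inv-fun w k))
    (λ w⁻¹l≡k → trans (cong (fun w) (sym w⁻¹l≡k)) (fun-inv w l))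

_≤ᴮ_ : (ℕ → ℕ) → (ℕ → ℕ) → Set
v ≤ᴮ w = ∀ i j → rank w i j ≤ rank v i j

≤ᴮ-trans : ∀ {u v w} → u ≤ᴮ v → v ≤ᴮ w → u ≤ᴮ w
≤ᴮ-trans u≤v v≤w i j = ≤-trans (v≤w i j) (u≤v i j)

rank-all-rows : ∀ f i j → (∀ k → k < i → f k < j) → rank f i j ≡ i
rank-all-rows f i j below = sumBelow-ones i _ (λ k k<i → 𝟙-yes (f k <? j) (below k k<i))

rank-split-columns : ∀ {n} (w : FinPerm n) i j d →
  rank (fun w) i (j + d) ≡ rank (fun w) i j + sumBelow d (λ e → 𝟙 (inv w (j + e) <? i))
rank-split-columns w i j d = begin
  rank (fun w) i (j + d)                          ≡⟨ rank-by-columns w i (j + d) ⟩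
  sumBelow (j + d) (λ l → 𝟙 (inv w l <? i))       ≡⟨ sumBelow-split j d _ ⟩
  sumBelow j (λ l → 𝟙 (inv w l <? i)) + hits      ≡⟨ cong (_+ hits) (sym (rank-by-columns w i j)) ⟩
  rank (fun w) i j + hits                         ∎
  where
  open ≡-Reasoning
  hits : ℕ
  hits = sumBelow d (λ e → 𝟙 (inv w (j + e) <? i))

rank-columns-≤ : ∀ {n} (w : FinPerm n) i j d → rank (fun w) i (j + d) ≤ rank (fun w) i j + d
rank-columns-≤ w i j d = subst (_≤ rank (fun w) i j + d) (sym (rank-split-columns w i j d))
  (+-monoʳ-≤ (rank (fun w) i j) (sumBelow-≤ d _ (λ e → 𝟙≤1 (inv w (j + e) <? i))))

rank-columns-full : ∀ {n} (w : FinPerm n) i j d → (∀ e → e < d → inv w (j + e) < i) →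
  rank (fun w) i (j + d) ≡ rank (fun w) i j + d
rank-columns-full w i j d hit = trans (rank-split-columns w i j d)
  (cong (rank (fun w) i j +_) (sumBelow-ones d _ (λ e e<d → 𝟙-yes (inv w (j + e) <? i) (hit e e<d))))

rank-beyond-rows : ∀ {n} (w : FinPerm n) i j → n ≤ i → rank (fun w) i j ≡ sumBelow j (λ l → 𝟙 (l <? i))
rank-beyond-rows {n} w i j n≤i = trans (rank-by-columns w i j) (sumBelow-cong j (λ l _ → same l))
  where
  same : ∀ l → 𝟙 (inv w l <? i) ≡ 𝟙 (l <? i)
  same l with l <? n
  ... | yes l<n = trans (𝟙-yes (inv w l <? i) (<-≤-trans (inv-bounded w l l<n) n≤i))
                        (sym (𝟙-yes (l <? i) (<-≤-trans l<n n≤i)))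
  ... | no l≮n = cong (λ x → 𝟙 (x <? i)) (inv-fixes w l (≮⇒≥ l≮n))

rank-beyond-columns : ∀ {n} (w : FinPerm n) i j → n ≤ j → rank (fun w) i j ≡ sumBelow i (λ k → 𝟙 (k <? j))
rank-beyond-columns w i j n≤j = trans (rank-by-columns w i j) (rank-beyond-rows (inverse w) j i n≤j)

≤ᴮ-from-box : ∀ {a b} B (v : FinPerm a) (w : FinPerm b) → a ≤ B → b ≤ B →
  (∀ i j → i ≤ B → j ≤ B → rank (fun w) i j ≤ rank (fun v) i j) → fun v ≤ᴮ fun w
≤ᴮ-from-box B v w a≤B b≤B inBox i j with i ≤? B | j ≤? B
... | yes i≤B | yes j≤B = inBox i j i≤B j≤B
... | no i≰B | _ = ≤-reflexive (trans (rank-beyond-rows w i j (≤-trans b≤B B≤i))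
                                      (sym (rank-beyond-rows v i j (≤-trans a≤B B≤i))))
  where B≤i = <⇒≤ (≰⇒> i≰B)
... | yes _ | no j≰B = ≤-reflexive (trans (rank-beyond-columns w i j (≤-trans b≤B B≤j))
                                          (sym (rank-beyond-columns v i j (≤-trans a≤B B≤j))))
  where B≤j = <⇒≤ (≰⇒> j≰B)

-- (3) One transposition step

transpose : ℕ → ℕ → ℕ → ℕ
transpose a c x with x ≟ a
... | yes _ = c
... | no _ with x ≟ c
...   | yes _ = a
...   | no _  = x

transpose-left : ∀ a c → transpose a c a ≡ c
transpose-left a c with a ≟ a
... | yes _ = refl
... | no a≢a = ⊥-elim (a≢a refl)

transpose-right : ∀ a c → transpose a c c ≡ a
transpose-right a c with c ≟ a
... | yes c≡a = c≡a
... | no _ with c ≟ c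
...   | yes _ = refl
...   | no c≢c = ⊥-elim (c≢c refl)

transpose-other : ∀ a c x → x ≢ a → x ≢ c → transpose a c x ≡ x
transpose-other a c x x≢a x≢c with x ≟ a
... | yes x≡a = ⊥-elim (x≢a x≡a)
... | no _ with x ≟ c
...   | yes x≡c = ⊥-elim (x≢c x≡c)
...   | no _ = refl

transpose-involutive : ∀ a c x → transpose a c (transpose a c x) ≡ x
transpose-involutive a c x with x ≟ a
... | yes refl = transpose-right x c
... | no x≢a with x ≟ c
...   | yes refl = transpose-left a x
...   | no x≢c = transpose-other a c x x≢a x≢c

_∘⟨_,_⟩ : ∀ {n} (w : FinPerm n) a c → a < n → c < n → FinPerm n
(w ∘⟨ a , c ⟩) a<n c<n = record
  { fun = fun w ∘ transpose a c
  ; inv = transpose a c ∘ inv w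
  ; fun-inv = λ x → trans (cong (fun w) (transpose-involutive a c (inv w x))) (fun-inv w x)
  ; inv-fun = λ x → trans (cong (transpose a c) (inv-fun w (transpose a c x))) (transpose-involutive a c x)
  ; fixes = λ x n≤x → trans (cong (fun w) (transpose-other a c x (≢-below a<n n≤x) (≢-below c<n n≤x)))
                            (fixes w x n≤x) }
  where
  ≢-below : ∀ {y n x} → y < n → n ≤ x → x ≢ y
  ≢-below y<n n≤x refl = <⇒≱ y<n n≤x

module SumsUnderTransposition (t : ℕ → ℕ) {a c : ℕ} (a<c : a < c) where

  t′ : ℕ → ℕ
  t′ = t ∘ transpose a c

  before : ∀ i → i ≤ a → sumBelow i t′ ≡ sumBelow i t
  before zero    _   = refl
  before (suc i) i<a = cong₂ _+_ (before i (<⇒≤ i<a))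
    (cong t (transpose-other a c i (<⇒≢ i<a) (<⇒≢ (<-trans i<a a<c))))

  between : ∀ i → a < i → i ≤ c → sumBelow i t′ + t a ≡ sumBelow i t + t c
  between (suc i) (s≤s a≤i) i<c with m≤n⇒m<n∨m≡n a≤i
  ... | inj₂ refl rewrite before i ≤-refl | transpose-left i c = xy∙z≈xz∙y (sumBelow i t) (t c) (t i)
  ... | inj₁ a<i rewrite transpose-other a c i (≢-sym (<⇒≢ a<i)) (<⇒≢ i<c) = begin
    sumBelow i t′ + t i + t a ≡⟨ xy∙z≈xz∙y (sumBelow i t′) (t i) (t a) ⟩
    sumBelow i t′ + t a + t i ≡⟨ cong (_+ t i) (between i a<i (<⇒≤ i<c)) ⟩
    sumBelow i t + t c + t i  ≡⟨ xy∙z≈xz∙y (sumBelow i t) (t c) (t i) ⟩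
    sumBelow i t + t i + t c  ∎
    where open ≡-Reasoning

  after : ∀ i → c < i → sumBelow i t′ ≡ sumBelow i t
  after (suc i) (s≤s c≤i) with m≤n⇒m<n∨m≡n c≤i
  ... | inj₂ refl rewrite transpose-right a i = between i a<c ≤-refl
  ... | inj₁ c<i rewrite transpose-other a c i (≢-sym (<⇒≢ (<-trans a<c c<i))) (≢-sym (<⇒≢ c<i)) =
    cong (_+ t i) (after i c<i)

record MaximumIn (f : ℕ → ℕ) (a N : ℕ) : Set where
  field
    pos     : ℕ
    a<pos   : a < pos
    pos≤N   : pos ≤ N
    maximal : ∀ k → a < k → k ≤ N → f k ≤ f pos

maximumIn : ∀ f a N → a < N → MaximumIn f a N
maximumIn f a (suc N) a<1+N with a <? N
... | no a≮N = record
  { pos = suc N ; a<pos = a<1+N ; pos≤N = ≤-refl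
  ; maximal = λ k a<k k≤1+N → ≤-reflexive (cong f (≤-antisym k≤1+N (≤-trans (s≤s (≮⇒≥ a≮N)) a<k))) }
... | yes a<N with maximumIn f a N a<N
...   | record { pos = c ; a<pos = a<c ; pos≤N = c≤N ; maximal = max-c } with f (suc N) ≤? f c
...     | yes last≤ = record
  { pos = c ; a<pos = a<c ; pos≤N = m≤n⇒m≤1+n c≤N
  ; maximal = λ k a<k k≤1+N → [ (λ k<1+N → max-c k a<k (≤-pred k<1+N)) , (λ { refl → last≤ }) ]
                                 (m≤n⇒m<n∨m≡n k≤1+N) }
...     | no last≰ = record
  { pos = suc N ; a<pos = a<1+N ; pos≤N = ≤-refl
  ; maximal = λ k a<k k≤1+N → [ (λ k<1+N → ≤-trans (max-c k a<k (≤-pred k<1+N)) (<⇒≤ (≰⇒> last≰)))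
                                 , (λ { refl → ≤-refl }) ] (m≤n⇒m<n∨m≡n k≤1+N) }

-- For w ∈ S_{N+1} with a = w⁻¹(N) < N, let c maximise w on (a, N] and
-- u = w ∘ (a c).  Then u ≤ᴮ w, every v ∈ S_N with v ≤ᴮ w satisfies v ≤ᴮ u, and
-- u⁻¹(N) = c > a, so the preimage of N has moved strictly to the right.
module TranspositionStep {N} (w : FinPerm (suc N)) (a<N : inv w N < N) where

  a : ℕ
  a = inv w N

  open MaximumIn (maximumIn (fun w) a N a<N) public
    renaming (pos to c; a<pos to a<c; pos≤N to c≤N; maximal to c-maximal)

  u : FinPerm (suc N)
  u = (w ∘⟨ a , c ⟩) (m<n⇒m<1+n a<N) (s≤s c≤N)

  u⁻¹N≡c : inv u N ≡ c
  u⁻¹N≡c = transpose-left a c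

  w-c<N : fun w c < N
  w-c<N with m≤n⇒m<n∨m≡n (≤-pred (fun-bounded w c (s≤s c≤N)))
  ... | inj₁ wc<N = wc<N
  ... | inj₂ wc≡N = ⊥-elim (<⇒≢ a<c (trans (cong (inv w) (sym wc≡N)) (inv-fun w c)))

  -- Rows i ≤ a or i > c contain both or neither of a and c, so the rank is unchanged.
  rank-u-outside : ∀ i j → i ≤ a ⊎ c < i → rank (fun u) i j ≡ rank (fun w) i j
  rank-u-outside i j (inj₁ i≤a) = SumsUnderTransposition.before (λ k → 𝟙 (fun w k <? j)) a<c i i≤a
  rank-u-outside i j (inj₂ c<i) = SumsUnderTransposition.after (λ k → 𝟙 (fun w k <? j)) a<c i c<i

  -- For a < i ≤ c, row a (with w a = N) is replaced by row c.
  rank-u-inside : ∀ i j → a < i → i ≤ c →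
    rank (fun u) i j + 𝟙 (N <? j) ≡ rank (fun w) i j + 𝟙 (fun w c <? j)
  rank-u-inside i j a<i i≤c =
    subst (λ x → rank (fun u) i j + 𝟙 (x <? j) ≡ rank (fun w) i j + 𝟙 (fun w c <? j)) (fun-inv w N)
      (SumsUnderTransposition.between (λ k → 𝟙 (fun w k <? j)) a<c i a<i i≤c)

  rank-u-inside-at : ∀ {i j} x y → 𝟙 (N <? j) ≡ x → 𝟙 (fun w c <? j) ≡ y → a < i → i ≤ c →
    rank (fun u) i j + x ≡ rank (fun w) i j + y
  rank-u-inside-at {i} {j} x y ≡x ≡y a<i i≤c =
    subst₂ (λ p q → rank (fun u) i j + p ≡ rank (fun w) i j + q) ≡x ≡y (rank-u-inside i j a<i i≤c)

  region : ∀ i → (i ≤ a ⊎ c < i) ⊎ (a < i × i ≤ c)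
  region i with i ≤? a | c <? i
  ... | yes i≤a | _       = inj₁ (inj₁ i≤a)
  ... | no _    | yes c<i = inj₁ (inj₂ c<i)
  ... | no i≰a  | no c≮i  = inj₂ (≰⇒> i≰a , ≮⇒≥ c≮i)

  u-below : fun u ≤ᴮ fun w
  u-below i j with region i
  ... | inj₁ outside = ≤-reflexive (sym (rank-u-outside i j outside))
  ... | inj₂ (a<i , i≤c) = +-cancelʳ-≤ (𝟙 (N <? j)) (rank (fun w) i j) (rank (fun u) i j) (begin
    rank (fun w) i j + 𝟙 (N <? j)
      ≤⟨ +-monoʳ-≤ (rank (fun w) i j) (𝟙-mono (N <? j) (fun w c <? j) (<-trans w-c<N)) ⟩
    rank (fun w) i j + 𝟙 (fun w c <? j)  ≡⟨ sym (rank-u-inside i j a<i i≤c) ⟩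
    rank (fun u) i j + 𝟙 (N <? j)        ∎)
    where open ≤-Reasoning

  -- For a < i ≤ c and w c < j ≤ N, every column l ∈ [j, N]
  -- is hit by some row < i under w (a row in (a, N] hitting l would beat c), so
  -- w has full rank i in the first N + 1 columns one column later than any
  -- v ∈ S_N could; hence w has strictly smaller rank than v at (i, j).
  rank-gap : ∀ i j → a < i → i ≤ c → fun w c < j → j ≤ N → (v : FinPerm N) →
    rank (fun w) i j < rank (fun v) i j
  rank-gap i j a<i i≤c wc<j j≤N v = +-cancelʳ-≤ d (suc (rank (fun w) i j)) (rank (fun v) i j) (begin
    suc (rank (fun w) i j) + d ≡⟨ sym (+-suc (rank (fun w) i j) d) ⟩
    rank (fun w) i j + suc d   ≡⟨ sym (rank-columns-full w i j (suc d) columns-hit) ⟩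
    rank (fun w) i (j + suc d) ≡⟨ rank-all-rows (fun w) i (j + suc d) w-rows ⟩
    i                          ≡⟨ sym (rank-all-rows (fun v) i (j + d) v-rows) ⟩
    rank (fun v) i (j + d)     ≤⟨ rank-columns-≤ v i j d ⟩
    rank (fun v) i j + d       ∎)
    where
    open ≤-Reasoning
    d : ℕ
    d = N ∸ j
    j+d≡N : j + d ≡ N
    j+d≡N = m+[n∸m]≡n j≤N
    i≤N : i ≤ N
    i≤N = ≤-trans i≤c c≤N
    w-rows : ∀ k → k < i → fun w k < j + suc d
    w-rows k k<i = subst (fun w k <_) (sym (trans (+-suc j d) (cong suc j+d≡N)))
                         (fun-bounded w k (<-≤-trans k<i (m≤n⇒m≤1+n i≤N)))
    v-rows : ∀ k → k < i → fun v k < j + d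
    v-rows k k<i = subst (fun v k <_) (sym j+d≡N) (fun-bounded v k (<-≤-trans k<i i≤N))
    columns-hit : ∀ e → e < suc d → inv w (j + e) < i
    columns-hit e e<1+d with i ≤? inv w (j + e)
    ... | no i≰ = ≰⇒> i≰
    ... | yes i≤ = ⊥-elim (<⇒≱ wc<j (≤-trans (m≤m+n j e) (subst (_≤ fun w c) (fun-inv w (j + e))
                     (c-maximal _ (<-≤-trans a<i i≤) (≤-pred (inv-bounded w (j + e) (s≤s l≤N)))))))
      where
      l≤N : j + e ≤ N
      l≤N = subst (j + e ≤_) j+d≡N (+-monoʳ-≤ j (≤-pred e<1+d))

  u-greatest : (v : FinPerm N) → fun v ≤ᴮ fun w → fun v ≤ᴮ fun u
  u-greatest v v≤w i j with region i
  ... | inj₁ outside = subst (_≤ rank (fun v) i j) (sym (rank-u-outside i j outside)) (v≤w i j)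
  ... | inj₂ (a<i , i≤c) = inside (j ≤? fun w c) (N <? j)
    where
    open ≤-Reasoning
    inside : Dec (j ≤ fun w c) → Dec (N < j) → rank (fun u) i j ≤ rank (fun v) i j
    -- j ≤ w c: neither row counts, or only row a does; the rank can only drop.
    inside (yes j≤wc) _ = begin
      rank (fun u) i j                 ≤⟨ m≤m+n (rank (fun u) i j) (𝟙 (N <? j)) ⟩
      rank (fun u) i j + 𝟙 (N <? j)
        ≡⟨ rank-u-inside-at (𝟙 (N <? j)) 0 refl (𝟙-no _ (≤⇒≯ j≤wc)) a<i i≤c ⟩
      rank (fun w) i j + 0             ≡⟨ +-identityʳ (rank (fun w) i j) ⟩
      rank (fun w) i j                 ≤⟨ v≤w i j ⟩
      rank (fun v) i j                 ∎
    -- N < j: both rows count, the rank is unchanged.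
    inside (no j≰wc) (yes N<j) = begin
      rank (fun u) i j ≡⟨ +-cancelʳ-≡ 1 (rank (fun u) i j) (rank (fun w) i j)
                            (rank-u-inside-at 1 1 (𝟙-yes _ N<j) (𝟙-yes _ (<-trans w-c<N N<j)) a<i i≤c) ⟩
      rank (fun w) i j ≤⟨ v≤w i j ⟩
      rank (fun v) i j ∎
    -- w c < j ≤ N: only row c counts; the rank rises by one, absorbed by the gap.
    inside (no j≰wc) (no N≮j) = begin
      rank (fun u) i j      ≡⟨ sym (+-identityʳ (rank (fun u) i j)) ⟩
      rank (fun u) i j + 0  ≡⟨ rank-u-inside-at 0 1 (𝟙-no _ N≮j) (𝟙-yes _ (≰⇒> j≰wc)) a<i i≤c ⟩
      rank (fun w) i j + 1  ≡⟨ +-comm (rank (fun w) i j) 1 ⟩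
      suc (rank (fun w) i j) ≤⟨ rank-gap i j a<i i≤c (≰⇒> j≰wc) (≮⇒≥ N≮j) v ⟩
      rank (fun v) i j      ∎

-- (4) The greatest element of S_m below a finitary permutation

record GreatestBelow (m : ℕ) {n} (w : FinPerm n) : Set where
  field
    top          : FinPerm m
    top-below    : fun top ≤ᴮ fun w
    top-greatest : (v : FinPerm m) → fun v ≤ᴮ fun w → fun v ≤ᴮ fun top

GreatestBelow-transfer : ∀ {m n n′} {w : FinPerm n} (u : FinPerm n′) → fun u ≤ᴮ fun w →
  ((v : FinPerm m) → fun v ≤ᴮ fun w → fun v ≤ᴮ fun u) → GreatestBelow m u → GreatestBelow m w
GreatestBelow-transfer u u≤w above greatest = record
  { top = top ; top-below = ≤ᴮ-trans top-below u≤w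
  ; top-greatest = λ v v≤w → top-greatest v (above v v≤w) }
  where open GreatestBelow greatest

restrict : ∀ {N} (w : FinPerm (suc N)) → inv w N ≡ N → GreatestBelow N w
restrict {N} w w⁻¹N≡N = record
  { top = record { fun = fun w ; inv = inv w ; fun-inv = fun-inv w ; inv-fun = inv-fun w ; fixes = fixes-N }
  ; top-below = λ _ _ → ≤-refl
  ; top-greatest = λ _ v≤w → v≤w }
  where
  fixes-N : ∀ x → N ≤ x → fun w x ≡ x
  fixes-N x N≤x with m≤n⇒m<n∨m≡n N≤x
  ... | inj₁ N<x = fixes w x N<x
  ... | inj₂ refl = trans (cong (fun w) (sym w⁻¹N≡N)) (fun-inv w N)

-- Iterating the transposition step: each step moves w⁻¹(N) strictly to the
-- right, so after at most d steps (where N ≤ w⁻¹(N) + d) the value N is fixed.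
descend : ∀ N d (w : FinPerm (suc N)) → N ≤ inv w N + d → GreatestBelow N w
descend N d w N≤a+d with N ≤? inv w N
... | yes N≤a = restrict w (≤-antisym (≤-pred (inv-bounded w N ≤-refl)) N≤a)
descend N zero w N≤a+0 | no N≰a = ⊥-elim (N≰a (subst (N ≤_) (+-identityʳ (inv w N)) N≤a+0))
descend N (suc d) w N≤a+1+d | no N≰a =
  GreatestBelow-transfer u u-below u-greatest (descend N d u N≤c+d)
  where
  open TranspositionStep w (≰⇒> N≰a)
  open ≤-Reasoning
  N≤c+d : N ≤ inv u N + d
  N≤c+d = begin
    N                  ≤⟨ N≤a+1+d ⟩
    inv w N + suc d    ≡⟨ +-suc (inv w N) d ⟩
    suc (inv w N) + d  ≤⟨ +-monoˡ-≤ d a<c ⟩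
    c + d              ≡⟨ cong (_+ d) (sym u⁻¹N≡c) ⟩
    inv u N + d        ∎

greatestBelow : ∀ m {n} (w : FinPerm n) → GreatestBelow m w
greatestBelow m {n} w with n ≤? m
... | yes n≤m = record
  { top = weaken n≤m w ; top-below = λ _ _ → ≤-refl ; top-greatest = λ _ v≤w → v≤w }
greatestBelow m {zero} w | no 0≰m = ⊥-elim (0≰m z≤n)
greatestBelow m {suc N} w | no 1+N≰m =
  GreatestBelow-transfer top top-below (λ v v≤w → top-greatest (weaken m≤N v) v≤w) (greatestBelow m top)
  where
  open GreatestBelow (descend N N w (m≤n+m N (inv w N)))
  m≤N : m ≤ N
  m≤N = ≤-pred (≰⇒> 1+N≰m)

-- (5) Permutations of Fin n and the matrices of Defs

extend : ∀ {n} → (Fin n → Fin n) → ℕ → ℕ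
extend {n} h x with x <? n
... | yes x<n = toℕ (h (fromℕ< x<n))
... | no _    = x

extend-inside : ∀ {n} (h : Fin n → Fin n) x (x<n : x < n) → extend h x ≡ toℕ (h (fromℕ< x<n))
extend-inside {n} h x x<n with x <? n
... | yes _   = refl
... | no x≮n = ⊥-elim (x≮n x<n)

extend-outside : ∀ {n} (h : Fin n → Fin n) x → ¬ x < n → extend h x ≡ x
extend-outside {n} h x x≮n with x <? n
... | yes x<n = ⊥-elim (x≮n x<n)
... | no _    = refl

extend-toℕ : ∀ {n} (h : Fin n → Fin n) (i : Fin n) → extend h (toℕ i) ≡ toℕ (h i)
extend-toℕ h i = trans (extend-inside h (toℕ i) (toℕ<n i)) (cong (toℕ ∘ h) (fromℕ<-toℕ i (toℕ<n i)))

extend-inverse : ∀ {n} (h g : Fin n → Fin n) → (∀ y → h (g y) ≡ y) → ∀ x → extend h (extend g x) ≡ x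
extend-inverse {n} h g hg x with x <? n
... | yes x<n = trans (extend-toℕ h (g (fromℕ< x<n))) (trans (cong toℕ (hg _)) (toℕ-fromℕ< x<n))
... | no x≮n  = extend-outside h x x≮n

toFinPerm : ∀ {n} → Permutation′ n → FinPerm n
toFinPerm w = record
  { fun = extend (w ⟨$⟩ʳ_) ; inv = extend (w ⟨$⟩ˡ_)
  ; fun-inv = extend-inverse _ _ (λ _ → inverseʳ w)
  ; inv-fun = extend-inverse _ _ (λ _ → inverseˡ w)
  ; fixes = λ x n≤x → extend-outside _ x (≤⇒≯ n≤x) }

fromFinPerm : ∀ {n} → FinPerm n → Permutation′ n
fromFinPerm {n} u = permutation (restrictTo (fun u) (fun-bounded u)) (restrictTo (inv u) (inv-bounded u))
  (λ y → toℕ-injective (restrict-inverse (fun u) (inv u) (fun-bounded u) (inv-bounded u) (fun-inv u) y))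
  (λ y → toℕ-injective (restrict-inverse (inv u) (fun u) (inv-bounded u) (fun-bounded u) (inv-fun u) y))
  where
  restrictTo : (f : ℕ → ℕ) → (∀ x → x < n → f x < n) → Fin n → Fin n
  restrictTo f bounded i = fromℕ< (bounded (toℕ i) (toℕ<n i))
  restrict-inverse : ∀ f g (f-bd : ∀ x → x < n → f x < n) (g-bd : ∀ x → x < n → g x < n) →
    (∀ x → f (g x) ≡ x) → ∀ y → toℕ (restrictTo f f-bd (restrictTo g g-bd y)) ≡ toℕ y
  restrict-inverse f g f-bd g-bd fg y
    rewrite toℕ-fromℕ< (f-bd _ (toℕ<n (restrictTo g g-bd y))) | toℕ-fromℕ< (g-bd (toℕ y) (toℕ<n y)) = fg (toℕ y)

toFinPerm-fromFinPerm : ∀ {n} (u : FinPerm n) x → fun (toFinPerm (fromFinPerm u)) x ≡ fun u x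
toFinPerm-fromFinPerm {n} u x with x <? n
... | yes x<n = trans (toℕ-fromℕ< (fun-bounded u _ (toℕ<n (fromℕ< x<n)))) (cong (fun u) (toℕ-fromℕ< x<n))
... | no x≮n  = sym (fixes u x (≮⇒≥ x≮n))

diagonal-entry : ∀ k l → (if k ≡ᵇ l then ℤ.+ 1 else ℤ.+ 0) ≡ ℤ.+ 𝟙 (k ≟ l)
diagonal-entry k l with k ≡ᵇ l in k≡ᵇl | k ≟ l
... | true  | yes _   = refl
... | true  | no k≢l  = ⊥-elim (k≢l (≡ᵇ⇒≡ k l (subst T (sym k≡ᵇl) _)))
... | false | yes k≡l = ⊥-elim (subst T k≡ᵇl (≡⇒≡ᵇ k l k≡l))
... | false | no _    = refl

padded-inside : ∀ {n} (A : Matrix n) k l (k<n : k < n) (l<n : l < n) → padded A k l ≡ A (fromℕ< k<n) (fromℕ< l<n)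
padded-inside {n} A k l k<n l<n with k <? n | l <? n
... | yes _   | yes _   = refl
... | yes _   | no l≮n  = ⊥-elim (l≮n l<n)
... | no k≮n  | _       = ⊥-elim (k≮n k<n)

padded-outside : ∀ {n} (A : Matrix n) k l → ¬ k < n ⊎ ¬ l < n → padded A k l ≡ ℤ.+ 𝟙 (k ≟ l)
padded-outside {n} A k l outside with k <? n | l <? n
... | yes k<n | yes l<n = ⊥-elim ([ (λ k≮n → k≮n k<n) , (λ l≮n → l≮n l<n) ] outside)
... | yes _   | no _    = diagonal-entry k l
... | no _    | _       = diagonal-entry k l

padded-permMatrix : ∀ {n} (w : Permutation′ n) k l → padded (permMatrix w) k l ≡ ℤ.+ 𝟙 (fun (toFinPerm w) k ≟ l)
padded-permMatrix {n} w k l = by-cases (k <? n) (l <? n)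
  where
  entry : ∀ (l<n : l < n) x → (if does (x ≟ᶠ fromℕ< l<n) then ℤ.+ 1 else ℤ.+ 0) ≡ ℤ.+ 𝟙 (toℕ x ≟ l)
  entry l<n x with x ≟ᶠ fromℕ< l<n
  ... | yes x≡l = cong ℤ.+_ (sym (𝟙-yes (toℕ x ≟ l) (trans (cong toℕ x≡l) (toℕ-fromℕ< l<n))))
  ... | no x≢l  = cong ℤ.+_ (sym (𝟙-no (toℕ x ≟ l)
                    (λ x≡l → x≢l (toℕ-injective (trans x≡l (sym (toℕ-fromℕ< l<n)))))))
  by-cases : Dec (k < n) → Dec (l < n) → padded (permMatrix w) k l ≡ ℤ.+ 𝟙 (fun (toFinPerm w) k ≟ l)
  by-cases (yes k<n) (yes l<n) = trans (padded-inside (permMatrix w) k l k<n l<n) (trans (entry l<n (w ⟨$⟩ʳ fromℕ< k<n))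
    (cong (λ x → ℤ.+ 𝟙 (x ≟ l)) (sym (extend-inside (w ⟨$⟩ʳ_) k k<n))))
  by-cases (yes k<n) (no l≮n) = trans (padded-outside (permMatrix w) k l (inj₂ l≮n))
    (cong ℤ.+_ (trans (𝟙-no (k ≟ l) (λ { refl → l≮n k<n }))
                      (sym (𝟙-no (_ ≟ l) (λ { refl → l≮n (fun-bounded (toFinPerm w) k k<n) })))))
  by-cases (no k≮n) _ = trans (padded-outside (permMatrix w) k l (inj₁ k≮n))
    (cong (λ x → ℤ.+ 𝟙 (x ≟ l)) (sym (extend-outside (w ⟨$⟩ʳ_) k k≮n)))

padded-embed : ∀ {n} N (A : Matrix n) → n ≤ N → ∀ k l → padded (embed N A) k l ≡ padded A k l
padded-embed {n} N A n≤N k l with k <? N | l <? N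
... | yes k<N | yes l<N = cong₂ (padded A) (toℕ-fromℕ< k<N) (toℕ-fromℕ< l<N)
... | yes _   | no l≮N  =
  trans (diagonal-entry k l) (sym (padded-outside A k l (inj₂ (λ l<n → l≮N (<-≤-trans l<n n≤N)))))
... | no k≮N  | _       =
  trans (diagonal-entry k l) (sym (padded-outside A k l (inj₁ (λ k<n → k≮N (<-≤-trans k<n n≤N)))))

Σ<-cong : ∀ i {f g : ℕ → ℤ} → (∀ k → k < i → f k ≡ g k) → Σ< i f ≡ Σ< i g
Σ<-cong zero    f≡g = refl
Σ<-cong (suc i) f≡g = cong₂ ℤ._+_ (Σ<-cong i (λ k k<i → f≡g k (m<n⇒m<1+n k<i))) (f≡g i ≤-refl)

Σ<-+ : ∀ i (f : ℕ → ℕ) → Σ< i (λ k → ℤ.+ f k) ≡ ℤ.+ sumBelow i f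
Σ<-+ zero    f = refl
Σ<-+ (suc i) f = cong (ℤ._+ ℤ.+ f i) (Σ<-+ i f)

cornerSum-embed : ∀ {n} N (A : Matrix n) → n ≤ N → ∀ i j → cornerSum (embed N A) i j ≡ cornerSum A i j
cornerSum-embed N A n≤N i j = Σ<-cong i (λ k _ → Σ<-cong j (λ l _ → padded-embed N A n≤N k l))

cornerSum-permMatrix : ∀ {n} N (w : Permutation′ n) → n ≤ N → ∀ i j →
  cornerSum (embed N (permMatrix w)) i j ≡ ℤ.+ rank (fun (toFinPerm w)) i j
cornerSum-permMatrix N w n≤N i j = begin
  cornerSum (embed N (permMatrix w)) i j
    ≡⟨ cornerSum-embed N (permMatrix w) n≤N i j ⟩
  Σ< i (λ k → Σ< j (λ l → padded (permMatrix w) k l))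
    ≡⟨ Σ<-cong i (λ k _ → trans (Σ<-cong j (λ l _ → padded-permMatrix w k l)) (Σ<-+ j _)) ⟩
  Σ< i (λ k → ℤ.+ sumBelow j (λ l → 𝟙 (fun (toFinPerm w) k ≟ l)))
    ≡⟨ Σ<-+ i _ ⟩
  ℤ.+ sumBelow i (λ k → sumBelow j (λ l → 𝟙 (fun (toFinPerm w) k ≟ l)))
    ≡⟨ cong ℤ.+_ (sumBelow-cong i (λ k _ → sumBelow-point _ j)) ⟩
  ℤ.+ rank (fun (toFinPerm w)) i j
    ∎
  where open ≡-Reasoning

≼⇒≤ᴮ : ∀ {a b} (v : Permutation′ a) (w : Permutation′ b) →
  permMatrix v ≼ permMatrix w → fun (toFinPerm v) ≤ᴮ fun (toFinPerm w)
≼⇒≤ᴮ {a} {b} v w v≼w = ≤ᴮ-from-box (a ⊔ b) (toFinPerm v) (toFinPerm w) (m≤m⊔n a b) (m≤n⊔m a b)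
  (λ i j i≤ j≤ → ℤP.drop‿+≤+ (subst₂ ℤ._≤_ (cornerSum-permMatrix (a ⊔ b) w (m≤n⊔m a b) i j)
                                         (cornerSum-permMatrix (a ⊔ b) v (m≤m⊔n a b) i j) (v≼w i j i≤ j≤)))

≤ᴮ⇒≼ : ∀ {a b} (v : Permutation′ a) (w : Permutation′ b) →
  fun (toFinPerm v) ≤ᴮ fun (toFinPerm w) → permMatrix v ≼ permMatrix w
≤ᴮ⇒≼ {a} {b} v w v≤w i j _ _ = subst₂ ℤ._≤_ (sym (cornerSum-permMatrix (a ⊔ b) w (m≤n⊔m a b) i j))
                                           (sym (cornerSum-permMatrix (a ⊔ b) v (m≤m⊔n a b) i j)) (+≤+ (v≤w i j))

minFin-const : ∀ {k} c → minFin {k} (λ _ → c) ≡ c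
minFin-const {zero}  c = refl
minFin-const {suc k} c = trans (cong (c ℤ.⊓_) (minFin-const {k} c)) (ℤP.⊓-idem c)

minFin-glb : ∀ {k} (f : Fin (suc k) → ℤ) x → (∀ t → x ℤ.≤ f t) → x ℤ.≤ minFin f
minFin-glb {zero}  f x x≤f = x≤f Fin.zero
minFin-glb {suc k} f x x≤f = ℤP.⊓-glb (x≤f Fin.zero) (minFin-glb (f ∘ Fin.suc) x (x≤f ∘ Fin.suc))

Σ<-zeros : ∀ i → Σ< i (λ _ → ℤ.+ 0) ≡ ℤ.+ 0
Σ<-zeros zero    = refl
Σ<-zeros (suc i) = cong (ℤ._+ ℤ.+ 0) (Σ<-zeros i)

Σ<-telescope : ∀ (D : ℕ → ℤ) j → Σ< j (λ l → D (suc l) ℤ.- D l) ≡ D j ℤ.- D 0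
Σ<-telescope D zero    = sym (ℤP.+-inverseʳ (D 0))
Σ<-telescope D (suc j) = trans (cong (ℤ._+ (D (suc j) ℤ.- D j)) (Σ<-telescope D j)) (chain (D 0) (D j) (D (suc j)))
  where
  chain : ∀ x y z → (y ℤ.- x) ℤ.+ (z ℤ.- y) ≡ z ℤ.- x
  chain = solve-∀

-- The join has the prescribed corner sums: its entries are the mixed second
-- differences of R = joinCornerSum, and R vanishes on the boundary i = 0 or j = 0.
cornerSum-join : ∀ {m k} (As : Fin (suc k) → Matrix m) i j → i ≤ m → j ≤ m →
  cornerSum (join As) i j ≡ joinCornerSum As i j
cornerSum-join {m} {k} As i j i≤m j≤m = begin
  cornerSum (join As) i j                     ≡⟨ Σ<-cong i (λ r r<i → row-sum r (<-≤-trans r<i i≤m)) ⟩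
  Σ< i (λ r → R (suc r) j ℤ.- R r j)          ≡⟨ Σ<-telescope (λ r → R r j) i ⟩
  R i j ℤ.- R 0 j                             ≡⟨ cong (ℤ._-_ (R i j)) (minFin-const {k} (ℤ.+ 0)) ⟩
  R i j ℤ.- ℤ.+ 0                             ≡⟨ ℤP.+-identityʳ (R i j) ⟩
  R i j                                       ∎
  where
  open ≡-Reasoning
  R : ℕ → ℕ → ℤ
  R = joinCornerSum As
  R-left : ∀ r → R r 0 ≡ ℤ.+ 0
  R-left r rewrite Σ<-zeros r = minFin-const {k} (ℤ.+ 0)
  join-entry : ∀ r l (r<m : r < m) (l<m : l < m) →
    join As (fromℕ< r<m) (fromℕ< l<m) ≡ R (suc r) (suc l) ℤ.- R r (suc l) ℤ.- R (suc r) l ℤ.+ R r l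
  join-entry r l r<m l<m rewrite toℕ-fromℕ< r<m | toℕ-fromℕ< l<m = refl
  regroup : ∀ w x y z → w ℤ.- x ℤ.- y ℤ.+ z ≡ (w ℤ.- x) ℤ.- (y ℤ.- z)
  regroup = solve-∀
  entry : ∀ r l → r < m → l < m →
    padded (join As) r l ≡ (R (suc r) (suc l) ℤ.- R r (suc l)) ℤ.- (R (suc r) l ℤ.- R r l)
  entry r l r<m l<m = trans (padded-inside (join As) r l r<m l<m)
    (trans (join-entry r l r<m l<m) (regroup (R (suc r) (suc l)) (R r (suc l)) (R (suc r) l) (R r l)))
  row-sum : ∀ r → r < m → Σ< j (λ l → padded (join As) r l) ≡ R (suc r) j ℤ.- R r j
  row-sum r r<m = begin
    Σ< j (λ l → padded (join As) r l)      ≡⟨ Σ<-cong j (λ l l<j → entry r l r<m (<-≤-trans l<j j≤m)) ⟩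
    Σ< j (λ l → D (suc l) ℤ.- D l)         ≡⟨ Σ<-telescope D j ⟩
    D j ℤ.- D 0                            ≡⟨ cong (ℤ._-_ (D j)) (cong₂ ℤ._-_ (R-left (suc r)) (R-left r)) ⟩
    D j ℤ.- ℤ.+ 0                          ≡⟨ ℤP.+-identityʳ (D j) ⟩
    D j                                    ∎
    where
    D : ℕ → ℤ
    D l = R (suc r) l ℤ.- R r l

join-least : ∀ {m k} (As : Fin (suc k) → Matrix m) (B : Matrix m) → (∀ t → As t ≼ B) → join As ≼ B
join-least {m} As B As≼B i j i≤ j≤ = begin
  cornerSum (embed (m ⊔ m) B) i j
    ≤⟨ minFin-glb _ _ (λ t → subst (cornerSum (embed (m ⊔ m) B) i j ℤ.≤_)
                                   (cornerSum-embed (m ⊔ m) (As t) m≤m⊔m i j) (As≼B t i j i≤ j≤)) ⟩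
  joinCornerSum As i j
    ≡⟨ sym (cornerSum-join As i j (subst (i ≤_) (⊔-idem m) i≤) (subst (j ≤_) (⊔-idem m) j≤)) ⟩
  cornerSum (join As) i j
    ≡⟨ sym (cornerSum-embed (m ⊔ m) (join As) m≤m⊔m i j) ⟩
  cornerSum (embed (m ⊔ m) (join As)) i j
    ∎
  where
  open ℤP.≤-Reasoning
  m≤m⊔m : m ≤ m ⊔ m
  m≤m⊔m = m≤m⊔n m m

-- w′ is the greatest element of S_m below w: it lies below w, and each wₜ lies
-- below w and hence below w′, so the join lies below w′ as well.
lemma4p6 : ∀ {m n k : ℕ} (ws : Fin (suc k) → Permutation′ m) (w : Permutation′ n) →
    (∀ t → permMatrix (ws t) ≼ permMatrix w) →
    Σ (Permutation′ m) (λ w′ →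
      (join (λ t → permMatrix (ws t)) ≼ permMatrix w′) × (permMatrix w′ ≼ permMatrix w))
lemma4p6 {m} ws w ws≼w = w′ , join≼w′ , w′≼w
  where
  open GreatestBelow (greatestBelow m (toFinPerm w))
  w′ : Permutation′ m
  w′ = fromFinPerm top
  rank-w′ : ∀ i j → rank (fun (toFinPerm w′)) i j ≡ rank (fun top) i j
  rank-w′ = rank-cong (toFinPerm-fromFinPerm top)
  w′≼w : permMatrix w′ ≼ permMatrix w
  w′≼w = ≤ᴮ⇒≼ w′ w (λ i j → subst (rank (fun (toFinPerm w)) i j ≤_) (sym (rank-w′ i j)) (top-below i j))
  wₜ≼w′ : ∀ t → permMatrix (ws t) ≼ permMatrix w′
  wₜ≼w′ t = ≤ᴮ⇒≼ (ws t) w′ (λ i j → subst (_≤ rank (fun (toFinPerm (ws t))) i j) (sym (rank-w′ i j))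
                              (top-greatest (toFinPerm (ws t)) (≼⇒≤ᴮ (ws t) w (ws≼w t)) i j))
  join≼w′ : join (λ t → permMatrix (ws t)) ≼ permMatrix w′
  join≼w′ = join-least (λ t → permMatrix (ws t)) (permMatrix w′) wₜ≼w′
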